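{- For all $n$, \[\mathrm{ex}(n,TT_4^-) = n \left\lfloor \frac{n-1}{2} \right\rfloor \left\lceil \frac{n-1}{2} \right\rceil,\] where $TT_4^-$ is the graph with vertex set $\{a,b,c,d\}$ and edge set $\{ab\to d,\ bc\to d,\ ac\to d\}$.
   Context: A $2\to1$ directed hypergraph (here simply a "graph") is a pair $H=(V,E)$ with $V$ a finite vertex set and $E$ a set of edges, each edge being a 3-element subset $\{a,b,c\}$ of $V$ with one element marked as the head; the edge with underlying set $\{a,b,c\}$ and head $c$ is written $ab \to c$. A triple of vertices may carry up to three distinct edges (one for each choice of head). A homomorphism $\phi:F\to G$ is a map $V(F)\to V(G)$ with $ab\to c\in E(F)\Rightarrow \phi(a)\phi(b)\to\phi(c)\in E(G)$. $G$ is $F$-free if there is no injective homomorphism $F\to G$. $\mathrm{ex}(n,F)$ is the maximum number of edges of an $F$-free graph on $n$ vertices. -}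

module Defs where

open import Data.Nat using (ℕ; zero; suc; _+_; _*_; _∸_; _<_; _≤_; _<ᵇ_; ⌊_/2⌋; ⌈_/2⌉)
open import Data.Fin using (Fin; toℕ) renaming (zero to fzero; suc to fsuc)
open import Data.Bool using (Bool; true; false; _∧_; if_then_else_)
open import Data.Product using (_×_; Σ; ∃; ∃-syntax)
open import Relation.Binary.PropositionalEquality using (_≡_; _≢_)
open import Relation.Nullary using (¬_)
open import Function.Definitions using (Injective)

-- A 2→1 directed hypergraph on vertex set Fin n.
-- edge a b c = true  means  the edge  ab → c  (underlying set {a,b}, head c).
-- Since {a,b} is unordered, edge is symmetric in its first two arguments;
-- edges are 3-element sets, so a, b, c are pairwise distinct.
record Graph (n : ℕ) : Set where
  field
    edge     : Fin n → Fin n → Fin n → Bool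
    sym      : ∀ a b c → edge a b c ≡ edge b a c
    distinct : ∀ a b c → edge a b c ≡ true → (a ≢ b) × (a ≢ c) × (b ≢ c)
open Graph public

ΣFin : (n : ℕ) → (Fin n → ℕ) → ℕ
ΣFin zero    f = 0
ΣFin (suc n) f = f fzero + ΣFin n (λ i → f (fsuc i))

-- Number of edges: each edge ab → c is counted once via toℕ a < toℕ b.
numEdges : ∀ {n} → Graph n → ℕ
numEdges {n} G =
  ΣFin n λ a → ΣFin n λ b → ΣFin n λ c →
    if (toℕ a <ᵇ toℕ b) ∧ edge G a b c then 1 else 0

IsHom : ∀ {k n} → Graph k → Graph n → (Fin k → Fin n) → Set
IsHom F G φ = ∀ a b c → edge F a b c ≡ true → edge G (φ a) (φ b) (φ c) ≡ true

Free : ∀ {k n} → Graph k → Graph n → Set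
Free {k} {n} F G = ¬ (Σ (Fin k → Fin n) λ φ → Injective _≡_ _≡_ φ × IsHom F G φ)

IsEx : ∀ {k} → Graph k → ℕ → ℕ → Set
IsEx F n m = (∃[ G ] (Free F G × numEdges {n} G ≡ m))
           × (∀ (G : Graph n) → Free F G → numEdges G ≤ m)

pairOK : Fin 4 → Fin 4 → Bool
pairOK fzero (fsuc fzero) = true
pairOK (fsuc fzero) fzero = true
pairOK (fsuc fzero) (fsuc (fsuc fzero)) = true
pairOK (fsuc (fsuc fzero)) (fsuc fzero) = true
pairOK fzero (fsuc (fsuc fzero)) = true
pairOK (fsuc (fsuc fzero)) fzero = true
pairOK _ _ = false

isD : Fin 4 → Bool
isD (fsuc (fsuc (fsuc fzero))) = true
isD _ = false

TT4e : Fin 4 → Fin 4 → Fin 4 → Bool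
TT4e x y z = pairOK x y ∧ isD z

private
  open import Relation.Binary.PropositionalEquality using (refl)
  open import Data.Product using (_,_)

  pairSym : ∀ x y → pairOK x y ≡ pairOK y x
  pairSym fzero fzero = refl
  pairSym fzero (fsuc fzero) = refl
  pairSym fzero (fsuc (fsuc fzero)) = refl
  pairSym fzero (fsuc (fsuc (fsuc fzero))) = refl
  pairSym (fsuc fzero) fzero = refl
  pairSym (fsuc fzero) (fsuc fzero) = refl
  pairSym (fsuc fzero) (fsuc (fsuc fzero)) = refl
  pairSym (fsuc fzero) (fsuc (fsuc (fsuc fzero))) = refl
  pairSym (fsuc (fsuc fzero)) fzero = refl
  pairSym (fsuc (fsuc fzero)) (fsuc fzero) = refl
  pairSym (fsuc (fsuc fzero)) (fsuc (fsuc fzero)) = refl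
  pairSym (fsuc (fsuc fzero)) (fsuc (fsuc (fsuc fzero))) = refl
  pairSym (fsuc (fsuc (fsuc fzero))) fzero = refl
  pairSym (fsuc (fsuc (fsuc fzero))) (fsuc fzero) = refl
  pairSym (fsuc (fsuc (fsuc fzero))) (fsuc (fsuc fzero)) = refl
  pairSym (fsuc (fsuc (fsuc fzero))) (fsuc (fsuc (fsuc fzero))) = refl

  TT4sym : ∀ x y z → TT4e x y z ≡ TT4e y x z
  TT4sym x y z rewrite pairSym x y = refl

  TT4dist : ∀ x y z → TT4e x y z ≡ true → (x ≢ y) × (x ≢ z) × (y ≢ z)
  TT4dist fzero (fsuc fzero) (fsuc (fsuc (fsuc fzero))) _ = (λ ()) , (λ ()) , (λ ())
  TT4dist (fsuc fzero) fzero (fsuc (fsuc (fsuc fzero))) _ = (λ ()) , (λ ()) , (λ ())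
  TT4dist (fsuc fzero) (fsuc (fsuc fzero)) (fsuc (fsuc (fsuc fzero))) _ = (λ ()) , (λ ()) , (λ ())
  TT4dist (fsuc (fsuc fzero)) (fsuc fzero) (fsuc (fsuc (fsuc fzero))) _ = (λ ()) , (λ ()) , (λ ())
  TT4dist fzero (fsuc (fsuc fzero)) (fsuc (fsuc (fsuc fzero))) _ = (λ ()) , (λ ()) , (λ ())
  TT4dist (fsuc (fsuc fzero)) fzero (fsuc (fsuc (fsuc fzero))) _ = (λ ()) , (λ ()) , (λ ())
  TT4dist fzero fzero _ ()
  TT4dist fzero (fsuc fzero) fzero ()
  TT4dist fzero (fsuc fzero) (fsuc fzero) ()
  TT4dist fzero (fsuc fzero) (fsuc (fsuc fzero)) ()
  TT4dist fzero (fsuc (fsuc fzero)) fzero ()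
  TT4dist fzero (fsuc (fsuc fzero)) (fsuc fzero) ()
  TT4dist fzero (fsuc (fsuc fzero)) (fsuc (fsuc fzero)) ()
  TT4dist fzero (fsuc (fsuc (fsuc fzero))) _ ()
  TT4dist (fsuc fzero) fzero fzero ()
  TT4dist (fsuc fzero) fzero (fsuc fzero) ()
  TT4dist (fsuc fzero) fzero (fsuc (fsuc fzero)) ()
  TT4dist (fsuc fzero) (fsuc fzero) _ ()
  TT4dist (fsuc fzero) (fsuc (fsuc fzero)) fzero ()
  TT4dist (fsuc fzero) (fsuc (fsuc fzero)) (fsuc fzero) ()
  TT4dist (fsuc fzero) (fsuc (fsuc fzero)) (fsuc (fsuc fzero)) ()
  TT4dist (fsuc fzero) (fsuc (fsuc (fsuc fzero))) _ ()
  TT4dist (fsuc (fsuc fzero)) fzero fzero ()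
  TT4dist (fsuc (fsuc fzero)) fzero (fsuc fzero) ()
  TT4dist (fsuc (fsuc fzero)) fzero (fsuc (fsuc fzero)) ()
  TT4dist (fsuc (fsuc fzero)) (fsuc fzero) fzero ()
  TT4dist (fsuc (fsuc fzero)) (fsuc fzero) (fsuc fzero) ()
  TT4dist (fsuc (fsuc fzero)) (fsuc fzero) (fsuc (fsuc fzero)) ()
  TT4dist (fsuc (fsuc fzero)) (fsuc (fsuc fzero)) _ ()
  TT4dist (fsuc (fsuc fzero)) (fsuc (fsuc (fsuc fzero))) _ ()
  TT4dist (fsuc (fsuc (fsuc fzero))) _ _ ()

-- The graph TT₄⁻ with vertices a=0, b=1, c=2, d=3 and edges ab→d, bc→d, ac→d.
TT4⁻ : Graph 4
TT4⁻ = record { edge = TT4e ; sym = TT4sym ; distinct = TT4dist }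

module Submission where

-- The link of a vertex c is the graph of pairs ab with ab → c.  A copy of TT₄⁻ with head c
-- is exactly a triangle in the link of c, so G is TT₄⁻-free iff every link is triangle-free.
-- The link of c lives on the other n − 1 vertices, so by Mantel's theorem it has at most
-- ⌊(n−1)/2⌋⌈(n−1)/2⌉ edges, and summing over c gives the upper bound.  Making every link a
-- balanced complete bipartite graph on the other n − 1 vertices attains it.
-- Mantel's theorem goes by induction, deleting both ends of an edge xy: as no vertex is
-- adjacent to both x and y, at most 2(k − 1) ordered adjacent pairs of a k-set meet {x, y}.

open import Defs hiding (sym)
open import Data.Bool using (Bool; true; false; _∧_; _∨_; not; if_then_else_)
open import Data.Bool.Properties using (∧-zeroʳ; ∨-comm) renaming (_≟_ to _≟ᵇ_)
open import Data.Empty using (⊥; ⊥-elim)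
open import Data.Fin using (Fin; toℕ) renaming (zero to fzero; suc to fsuc)
open import Data.Fin.Patterns using (0F; 1F; 2F; 3F)
open import Data.Fin.Properties using (_≟_; any?; toℕ-injective)
open import Data.Nat using (ℕ; zero; suc; _+_; _*_; _∸_; _≤_; _<_; _<ᵇ_; z≤n; s≤s; s≤s⁻¹; ⌊_/2⌋; ⌈_/2⌉)
open import Data.Nat.Properties hiding (_≟_)
open import Algebra.Properties.Semiring.Sum +-*-semiring
  using (sum; sum-syntax; sum-cong-≗; sum-replicate-zero; ∑-distrib-+; ∑-comm; *-distribˡ-sum; *-distribʳ-sum)
open import Data.Nat.Tactic.RingSolver using (solve-∀)
open import Data.Product using (_×_; _,_; proj₁; proj₂; Σ-syntax)
open import Data.Sum using (_⊎_; inj₁; inj₂)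
open import Function using (case_of_)
open import Relation.Binary.PropositionalEquality
open import Relation.Nullary using (¬_; Dec; yes; no; does)
open import Relation.Nullary.Decidable using (dec-false)
open import Relation.Nullary.Reflects using (ofʸ; ofⁿ)

⟦_⟧ : Bool → ℕ
⟦ b ⟧ = if b then 1 else 0

∧-true : ∀ {p q} → p ∧ q ≡ true → p ≡ true × q ≡ true
∧-true {true} q≡true = refl , q≡true

∧-true₃ : ∀ {p q r} → p ∧ q ∧ r ≡ true → p ≡ true × q ≡ true × r ≡ true
∧-true₃ {true} {true} r≡true = refl , refl , r≡true

∨-true : ∀ {p q} → p ∨ q ≡ true → p ≡ true ⊎ q ≡ true
∨-true {true}  _      = inj₁ refl
∨-true {false} q≡true = inj₂ q≡true

⟦∧⟧ : ∀ p q → ⟦ p ∧ q ⟧ ≡ ⟦ p ⟧ * ⟦ q ⟧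
⟦∧⟧ true  q = sym (+-identityʳ ⟦ q ⟧)
⟦∧⟧ false q = refl

⟦∨⟧ : ∀ {p q} → (p ≡ true → q ≡ true → ⊥) → ⟦ p ∨ q ⟧ ≡ ⟦ p ⟧ + ⟦ q ⟧
⟦∨⟧ {true}  {true}  excl = ⊥-elim (excl refl refl)
⟦∨⟧ {true}  {false} _    = refl
⟦∨⟧ {false} {q}     _    = refl

<ᵇ-true : ∀ {m n} → m < n → (m <ᵇ n) ≡ true
<ᵇ-true {m} {n} m<n with m <ᵇ n | <⇒<ᵇ m<n
... | true | _ = refl

<ᵇ-false : ∀ {m n} → ¬ m < n → (m <ᵇ n) ≡ false
<ᵇ-false {m} {n} m≮n with m <ᵇ n | <ᵇ-reflects-< m n
... | true  | ofʸ m<n = ⊥-elim (m≮n m<n)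
... | false | _       = refl

_≡ᵇ_ : ∀ {n} → Fin n → Fin n → Bool
a ≡ᵇ b = does (a ≟ b)

ΣFin≡sum : ∀ n (f : Fin n → ℕ) → ΣFin n f ≡ sum f
ΣFin≡sum zero    f = refl
ΣFin≡sum (suc n) f = cong (f fzero +_) (ΣFin≡sum n (λ i → f (fsuc i)))

sum-mono-≤ : ∀ {n} {f g : Fin n → ℕ} → (∀ i → f i ≤ g i) → sum f ≤ sum g
sum-mono-≤ {zero}  f≤g = z≤n
sum-mono-≤ {suc n} f≤g = +-mono-≤ (f≤g fzero) (sum-mono-≤ (λ i → f≤g (fsuc i)))

sum-const : ∀ n c → ∑[ i < n ] c ≡ n * c
sum-const zero    c = refl
sum-const (suc n) c = cong (c +_) (sum-const n c)

sum-δ : ∀ {n} (x : Fin n) (f : Fin n → ℕ) → ∑[ a < n ] (⟦ a ≡ᵇ x ⟧ * f a) ≡ f x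
sum-δ {suc n} fzero    f = trans (cong₂ _+_ (+-identityʳ (f fzero)) (sum-replicate-zero n)) (+-identityʳ (f fzero))
sum-δ {suc n} (fsuc x) f = sum-δ x (λ a → f (fsuc a))

∑∑-distrib-+ : ∀ {n} (f g : Fin n → Fin n → ℕ) →
  ∑[ a < n ] ∑[ b < n ] (f a b + g a b) ≡ ∑[ a < n ] ∑[ b < n ] f a b + ∑[ a < n ] ∑[ b < n ] g a b
∑∑-distrib-+ {n} f g = trans (sum-cong-≗ (λ a → ∑-distrib-+ (f a) (g a))) (∑-distrib-+ {n} _ _)

∑∑-product : ∀ {n} (f g : Fin n → ℕ) → ∑[ a < n ] ∑[ b < n ] (f a * g b) ≡ sum f * sum g
∑∑-product f g = trans (sum-cong-≗ (λ a → sym (*-distribˡ-sum (f a) g))) (sym (*-distribʳ-sum (sum g) f))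

Pred : ℕ → Set
Pred n = Fin n → Bool

count : ∀ {n} → Pred n → ℕ
count {n} S = ∑[ a < n ] ⟦ S a ⟧

full : ∀ {n} → Pred n
full _ = true

_─_ : ∀ {n} → Pred n → Fin n → Pred n
(S ─ x) a = if a ≡ᵇ x then false else S a

_∩_ : ∀ {n} → Pred n → Pred n → Pred n
(S ∩ P) a = S a ∧ P a

∁ : ∀ {n} → Pred n → Pred n
∁ P a = not (P a)

_⊆_ : ∀ {n} → Pred n → Pred n → Set
P ⊆ S = ∀ {a} → P a ≡ true → S a ≡ true

Disjoint : ∀ {n} → Pred n → Pred n → Set
Disjoint P Q = ∀ {a} → P a ≡ true → Q a ≡ true → ⊥

∈─ : ∀ {n} (S : Pred n) {x a} → S a ≡ true → a ≢ x → (S ─ x) a ≡ true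
∈─ S Sa a≢x rewrite dec-false (_ ≟ _) a≢x = Sa

∈─⇒≢ : ∀ {n} (S : Pred n) {x a} → (S ─ x) a ≡ true → a ≢ x
∈─⇒≢ S {x} {a} a∈S─x a≡x with a ≟ x
... | yes _  = case a∈S─x of λ ()
... | no a≢x = a≢x a≡x

─⊆ : ∀ {n} (S : Pred n) x → (S ─ x) ⊆ S
─⊆ S x {a} a∈S─x with a ≟ x
... | no _ = a∈S─x

∩-⊆ : ∀ {n} (S P : Pred n) → (S ∩ P) ⊆ S
∩-⊆ S P {a} a∈S∩P = proj₁ (∧-true {S a} a∈S∩P)

∩-∁-disjoint : ∀ {n} (S P : Pred n) → Disjoint (S ∩ P) (S ∩ ∁ P)
∩-∁-disjoint S P {a} a∈S∩P a∈S∩∁P with P a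
... | true  = case proj₂ (∧-true {S a} a∈S∩∁P) of λ ()
... | false = case proj₂ (∧-true {S a} a∈S∩P) of λ ()

count-─ : ∀ {n} (S : Pred n) x → count S ≡ ⟦ S x ⟧ + count (S ─ x)
count-─ {n} S x = begin
  count S                                               ≡⟨ sum-cong-≗ split ⟩
  ∑[ a < n ] (⟦ a ≡ᵇ x ⟧ * ⟦ S a ⟧ + ⟦ (S ─ x) a ⟧)      ≡⟨ ∑-distrib-+ {n} _ _ ⟩
  ∑[ a < n ] (⟦ a ≡ᵇ x ⟧ * ⟦ S a ⟧) + count (S ─ x)     ≡⟨ cong (_+ count (S ─ x)) (sum-δ x (λ a → ⟦ S a ⟧)) ⟩
  ⟦ S x ⟧ + count (S ─ x)                               ∎
  where
  open ≡-Reasoning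
  split : ∀ a → ⟦ S a ⟧ ≡ ⟦ a ≡ᵇ x ⟧ * ⟦ S a ⟧ + ⟦ (S ─ x) a ⟧
  split a with a ≟ x
  ... | yes _ = sym (trans (+-identityʳ _) (+-identityʳ _))
  ... | no _  = refl

count-─-∈ : ∀ {n} (S : Pred n) {x} → S x ≡ true → count S ≡ suc (count (S ─ x))
count-─-∈ S {x} Sx = trans (count-─ S x) (cong (λ b → ⟦ b ⟧ + count (S ─ x)) Sx)

count-full─ : ∀ {n} (c : Fin n) → count (full ─ c) ≡ n ∸ 1
count-full─ {n} c = cong (_∸ 1) (begin
  suc (count (full ─ c))  ≡⟨ count-─-∈ full {c} refl ⟨
  count {n} full          ≡⟨ sum-const n 1 ⟩
  n * 1                   ≡⟨ *-identityʳ n ⟩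
  n                       ∎)
  where open ≡-Reasoning

count-full─∩ : ∀ {n} (P : Pred n) x → count ((full ─ x) ∩ P) ≡ count (P ─ x)
count-full─∩ P x = sum-cong-≗ pointwise
  where
  pointwise : ∀ a → ⟦ ((full ─ x) ∩ P) a ⟧ ≡ ⟦ (P ─ x) a ⟧
  pointwise a with a ≟ x
  ... | yes _ = refl
  ... | no  _ = refl

count-disjoint-⊆ : ∀ {n} {P Q S : Pred n} → P ⊆ S → Q ⊆ S → Disjoint P Q → count P + count Q ≤ count S
count-disjoint-⊆ {n} {P} {Q} {S} P⊆S Q⊆S P∩Q=∅ =
  ≤-trans (≤-reflexive (sym (∑-distrib-+ {n} (λ a → ⟦ P a ⟧) (λ a → ⟦ Q a ⟧)))) (sum-mono-≤ pointwise)
  where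
  pointwise : ∀ a → ⟦ P a ⟧ + ⟦ Q a ⟧ ≤ ⟦ S a ⟧
  pointwise a with P a in p | Q a in q
  ... | true  | true  = ⊥-elim (P∩Q=∅ p q)
  ... | true  | false rewrite P⊆S p = ≤-refl
  ... | false | true  rewrite Q⊆S q = ≤-refl
  ... | false | false = z≤n

count-∩-∁ : ∀ {n} (S P : Pred n) → count (S ∩ P) + count (S ∩ ∁ P) ≡ count S
count-∩-∁ {n} S P =
  trans (sym (∑-distrib-+ {n} (λ a → ⟦ (S ∩ P) a ⟧) (λ a → ⟦ (S ∩ ∁ P) a ⟧))) (sum-cong-≗ pointwise)
  where
  pointwise : ∀ a → ⟦ S a ∧ P a ⟧ + ⟦ S a ∧ not (P a) ⟧ ≡ ⟦ S a ⟧
  pointwise a with S a | P a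
  ... | true  | true  = refl
  ... | true  | false = refl
  ... | false | _     = refl

below : ∀ {n} → ℕ → Pred n
below t a = toℕ a <ᵇ t

count-below : ∀ {n} t → t ≤ n → count {n} (below t) ≡ t
count-below {n}     zero    _         = sum-replicate-zero n
count-below {suc n} (suc t) (s≤s t≤n) = cong suc (count-below t t≤n)

Digraph : ℕ → Set
Digraph n = Fin n → Fin n → Bool

Symmetric : ∀ {n} → Digraph n → Set
Symmetric E = ∀ a b → E a b ≡ E b a

-- For symmetric E this says there is no triangle; Mantel's bound below counts ordered pairs
-- and holds for every relation without such a "transitive triangle".
TriangleFree : ∀ {n} → Digraph n → Set
TriangleFree E = ∀ a b d → E a b ≡ true → E b d ≡ true → E a d ≡ true → ⊥

_⊆²_ : ∀ {n} → Digraph n → Pred n → Set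
E ⊆² S = ∀ {a b} → E a b ≡ true → S a ≡ true × S b ≡ true

arcsIn : ∀ {n} → Pred n → Digraph n → ℕ
arcsIn {n} S E = ∑[ a < n ] ∑[ b < n ] ⟦ S a ∧ S b ∧ E a b ⟧

arcs edges : ∀ {n} → Digraph n → ℕ
arcs  {n} E = ∑[ a < n ] ∑[ b < n ] ⟦ E a b ⟧
edges {n} E = ∑[ a < n ] ∑[ b < n ] ⟦ (toℕ a <ᵇ toℕ b) ∧ E a b ⟧

N⁺ N⁻ : ∀ {n} → Digraph n → Pred n → Fin n → Pred n
N⁺ E S x b = S b ∧ E x b
N⁻ E S x a = S a ∧ E a x

triangleFree⇒loopless : ∀ {n} {E : Digraph n} → TriangleFree E → ∀ {a b} → E a b ≡ true → a ≢ b
triangleFree⇒loopless tf {a} Eab refl = tf a a a Eab Eab Eab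

arcsIn≡arcs : ∀ {n} {S : Pred n} {E : Digraph n} → E ⊆² S → arcsIn S E ≡ arcs E
arcsIn≡arcs {S = S} {E} E⊆S² = sum-cong-≗ (λ a → sum-cong-≗ (pointwise a))
  where
  pointwise : ∀ a b → ⟦ S a ∧ S b ∧ E a b ⟧ ≡ ⟦ E a b ⟧
  pointwise a b with E a b in arc
  ... | true  rewrite proj₁ (E⊆S² arc) | proj₂ (E⊆S² arc) = refl
  ... | false rewrite ∧-zeroʳ (S b) | ∧-zeroʳ (S a) = refl

arcs≡2*edges : ∀ {n} {E : Digraph n} → Symmetric E → (∀ a → E a a ≢ true) → arcs E ≡ 2 * edges E
arcs≡2*edges {n} {E} E-sym loopless = begin
  arcs E                                              ≡⟨ sum-cong-≗ (λ a → sum-cong-≗ (split a)) ⟩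
  ∑[ a < n ] ∑[ b < n ] (forward a b + forward b a)   ≡⟨ ∑∑-distrib-+ forward (λ a b → forward b a) ⟩
  edges E + ∑[ a < n ] ∑[ b < n ] forward b a         ≡⟨ cong (edges E +_) (∑-comm (λ a b → forward b a)) ⟩
  edges E + edges E                                   ≡⟨ cong (edges E +_) (sym (+-identityʳ (edges E))) ⟩
  2 * edges E                                         ∎
  where
  open ≡-Reasoning
  forward : Fin n → Fin n → ℕ
  forward a b = ⟦ (toℕ a <ᵇ toℕ b) ∧ E a b ⟧
  split : ∀ a b → ⟦ E a b ⟧ ≡ forward a b + forward b a
  split a b with toℕ a <ᵇ toℕ b | <ᵇ-reflects-< (toℕ a) (toℕ b)
               | toℕ b <ᵇ toℕ a | <ᵇ-reflects-< (toℕ b) (toℕ a)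
  ... | true  | ofʸ a<b | true  | ofʸ b<a = ⊥-elim (<-asym a<b b<a)
  ... | true  | _       | false | _       = sym (+-identityʳ _)
  ... | false | _       | true  | _       = cong ⟦_⟧ (E-sym a b)
  ... | false | ofⁿ a≮b | false | ofⁿ b≮a with refl ← toℕ-injective (≤-antisym (≮⇒≥ b≮a) (≮⇒≥ a≮b))
    with E a a in loop
  ...   | true  = ⊥-elim (loopless a loop)
  ...   | false = refl

arcsIn-─ : ∀ {n} (E : Digraph n) (S : Pred n) {x} → S x ≡ true →
  arcsIn S E ≡ arcsIn (S ─ x) E + (count (N⁺ E S x) + count (N⁻ E (S ─ x) x))
arcsIn-─ {n} E S {x} Sx = begin
  arcsIn S E
    ≡⟨ sum-cong-≗ (λ a → sum-cong-≗ (split a)) ⟩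
  ∑[ a < n ] ∑[ b < n ] (⟦ T a ∧ T b ∧ E a b ⟧ + (from-x a b + into-x a b))
    ≡⟨ ∑∑-distrib-+ (λ a b → ⟦ T a ∧ T b ∧ E a b ⟧) (λ a b → from-x a b + into-x a b) ⟩
  arcsIn T E + ∑[ a < n ] ∑[ b < n ] (from-x a b + into-x a b)
    ≡⟨ cong (arcsIn T E +_) (∑∑-distrib-+ from-x into-x) ⟩
  arcsIn T E + (∑[ a < n ] ∑[ b < n ] from-x a b + ∑[ a < n ] ∑[ b < n ] into-x a b)
    ≡⟨ cong (arcsIn T E +_) (cong₂ _+_ from-x-sum into-x-sum) ⟩
  arcsIn T E + (count (N⁺ E S x) + count (N⁻ E T x))
    ∎
  where
  open ≡-Reasoning
  T = S ─ x
  from-x into-x : Fin n → Fin n → ℕ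
  from-x a b = ⟦ a ≡ᵇ x ⟧ * ⟦ N⁺ E S x b ⟧
  into-x a b = ⟦ b ≡ᵇ x ⟧ * ⟦ N⁻ E T x a ⟧
  from-x-sum : ∑[ a < n ] ∑[ b < n ] from-x a b ≡ count (N⁺ E S x)
  from-x-sum = trans (sum-cong-≗ (λ a → sym (*-distribˡ-sum ⟦ a ≡ᵇ x ⟧ (λ b → ⟦ N⁺ E S x b ⟧))))
                     (sum-δ x (λ _ → count (N⁺ E S x)))
  into-x-sum : ∑[ a < n ] ∑[ b < n ] into-x a b ≡ count (N⁻ E T x)
  into-x-sum = sum-cong-≗ (λ a → sum-δ x (λ _ → ⟦ N⁻ E T x a ⟧))
  split : ∀ a b → ⟦ S a ∧ S b ∧ E a b ⟧ ≡ ⟦ T a ∧ T b ∧ E a b ⟧ + (from-x a b + into-x a b)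
  split a b with a ≟ x | b ≟ x
  ... | yes refl | yes refl rewrite Sx = sym (trans (+-identityʳ _) (+-identityʳ _))
  ... | yes refl | no _     rewrite Sx = sym (trans (+-identityʳ _) (+-identityʳ _))
  ... | no _     | yes refl rewrite Sx | ∧-zeroʳ (S a) = sym (+-identityʳ _)
  ... | no _     | no _     = sym (+-identityʳ _)

-- Mantel's theorem

∈─-head : ∀ {n} {E : Digraph n} → TriangleFree E → ∀ (S : Pred n) {x y} →
  S y ≡ true → E x y ≡ true → (S ─ x) y ≡ true
∈─-head tf S Sy Exy = ∈─ S Sy (λ y≡x → triangleFree⇒loopless tf Exy (sym y≡x))

count-─-arc : ∀ {n} {E : Digraph n} → TriangleFree E → ∀ (S : Pred n) {x y} →
  S x ≡ true → S y ≡ true → E x y ≡ true → count S ≡ suc (suc (count ((S ─ x) ─ y)))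
count-─-arc tf S {x} Sx Sy Exy =
  trans (count-─-∈ S Sx) (cong suc (count-─-∈ (S ─ x) (∈─-head tf S Sy Exy)))

-- Since x → y, no vertex is an out-neighbour of both x and y, nor an in-neighbour of both.
arcsIn-remove-arc : ∀ {n} {E : Digraph n} → TriangleFree E → ∀ (S : Pred n) {x y} →
  S x ≡ true → S y ≡ true → E x y ≡ true → arcsIn S E ≤ arcsIn ((S ─ x) ─ y) E + 2 * count (S ─ x)
arcsIn-remove-arc {n} {E} tf S {x} {y} Sx Sy Exy = begin
  arcsIn S E                              ≡⟨ arcsIn-─ E S Sx ⟩
  arcsIn T E + (o₁ + i₁)                  ≡⟨ cong (_+ (o₁ + i₁)) (arcsIn-─ E T Ty) ⟩
  (arcsIn T′ E + (o₂ + i₂)) + (o₁ + i₁)   ≡⟨ shuffle (arcsIn T′ E) o₂ i₂ o₁ i₁ ⟩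
  arcsIn T′ E + ((o₁ + o₂) + (i₁ + i₂))   ≤⟨ +-monoʳ-≤ (arcsIn T′ E) (+-mono-≤ out-bound in-bound) ⟩
  arcsIn T′ E + (count T + count T)       ≡⟨ cong (λ m → arcsIn T′ E + (count T + m)) (+-identityʳ _) ⟨
  arcsIn T′ E + 2 * count T               ∎
  where
  open ≤-Reasoning
  T T′ : Pred n
  T = S ─ x
  T′ = T ─ y
  Ty : T y ≡ true
  Ty = ∈─-head tf S Sy Exy
  o₁ o₂ i₁ i₂ : ℕ
  o₁ = count (N⁺ E S x)
  i₁ = count (N⁻ E T x)
  o₂ = count (N⁺ E T y)
  i₂ = count (N⁻ E T′ y)
  shuffle : ∀ a b c d e → (a + (b + c)) + (d + e) ≡ a + ((d + b) + (e + c))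
  shuffle = solve-∀
  out-bound : o₁ + o₂ ≤ count T
  out-bound = count-disjoint-⊆ {P = N⁺ E S x} {N⁺ E T y} {T}
    (λ Sb∧Exb → ∈─-head tf S (proj₁ (∧-true Sb∧Exb)) (proj₂ (∧-true Sb∧Exb)))
    (λ Tb∧Eyb → proj₁ (∧-true Tb∧Eyb))
    (λ {b} Sb∧Exb Tb∧Eyb → tf x y b Exy (proj₂ (∧-true Tb∧Eyb)) (proj₂ (∧-true Sb∧Exb)))
  in-bound : i₁ + i₂ ≤ count T
  in-bound = count-disjoint-⊆ {P = N⁻ E T x} {N⁻ E T′ y} {T}
    (λ Ta∧Eax → proj₁ (∧-true Ta∧Eax))
    (λ T′a∧Eay → ─⊆ T y (proj₁ (∧-true T′a∧Eay)))
    (λ {a} Ta∧Eax T′a∧Eay → tf a x y (proj₂ (∧-true Ta∧Eax)) Exy (proj₂ (∧-true T′a∧Eay)))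

arcsIn-arcless : ∀ {n} (S : Pred n) (E : Digraph n) →
  (∀ a b → S a ∧ S b ∧ E a b ≢ true) → arcsIn S E ≡ 0
arcsIn-arcless {n} S E no-arc =
  trans (sum-cong-≗ (λ a → trans (sum-cong-≗ (zero-at a)) (sum-replicate-zero n))) (sum-replicate-zero n)
  where
  zero-at : ∀ a b → ⟦ S a ∧ S b ∧ E a b ⟧ ≡ 0
  zero-at a b with S a ∧ S b ∧ E a b in arc
  ... | true  = ⊥-elim (no-arc a b arc)
  ... | false = refl

square-step : ∀ {a a′ k} → 2 * a′ ≤ k * k → a ≤ a′ + 2 * suc k → 2 * a ≤ suc (suc k) * suc (suc k)
square-step {a} {a′} {k} 2a′≤k² a≤ = begin
  2 * a                       ≤⟨ *-monoʳ-≤ 2 a≤ ⟩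
  2 * (a′ + 2 * suc k)        ≡⟨ *-distribˡ-+ 2 a′ (2 * suc k) ⟩
  2 * a′ + 2 * (2 * suc k)    ≤⟨ +-monoˡ-≤ (2 * (2 * suc k)) 2a′≤k² ⟩
  k * k + 2 * (2 * suc k)     ≡⟨ expand k ⟩
  suc (suc k) * suc (suc k)   ∎
  where
  open ≤-Reasoning
  expand : ∀ k → k * k + 2 * (2 * suc k) ≡ suc (suc k) * suc (suc k)
  expand = solve-∀

mantel-step : ∀ {n} {E : Digraph n} → TriangleFree E → ∀ (S : Pred n) {x y} →
  S x ≡ true → S y ≡ true → E x y ≡ true →
  2 * arcsIn ((S ─ x) ─ y) E ≤ count ((S ─ x) ─ y) * count ((S ─ x) ─ y) →
  2 * arcsIn S E ≤ count S * count S
mantel-step {E = E} tf S {x} {y} Sx Sy Exy ih rewrite count-─-arc tf S Sx Sy Exy =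
  square-step ih (subst (λ c → arcsIn S E ≤ arcsIn ((S ─ x) ─ y) E + 2 * c)
                        (count-─-∈ (S ─ x) (∈─-head tf S Sy Exy))
                        (arcsIn-remove-arc tf S Sx Sy Exy))

mantel-arcsIn : ∀ {n} {E : Digraph n} → TriangleFree E → ∀ (S : Pred n) → 2 * arcsIn S E ≤ count S * count S
mantel-arcsIn {n} {E} tf S = bounded (count S) S ≤-refl
  where
  arc? : ∀ S → Dec (Σ[ x ∈ Fin n ] Σ[ y ∈ Fin n ] S x ∧ S y ∧ E x y ≡ true)
  arc? S = any? (λ x → any? (λ y → S x ∧ S y ∧ E x y ≟ᵇ true))
  bounded : ∀ k S → count S ≤ k → 2 * arcsIn S E ≤ count S * count S
  bounded k S _ with arc? S
  bounded k S _ | no ∄arc rewrite arcsIn-arcless S E (λ a b arc → ∄arc (a , b , arc)) = z≤n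
  bounded zero S cS≤0 | yes (x , y , arc) with Sx , Sy , Exy ← ∧-true₃ arc
    with () ← subst (_≤ 0) (count-─-arc tf S Sx Sy Exy) cS≤0
  bounded (suc k) S cS≤1+k | yes (x , y , arc) with Sx , Sy , Exy ← ∧-true₃ arc =
    mantel-step tf S Sx Sy Exy (bounded k ((S ─ x) ─ y)
      (<⇒≤ (s≤s⁻¹ (subst (_≤ suc k) (count-─-arc tf S Sx Sy Exy) cS≤1+k))))

square≤ : ∀ k → k * k ≤ 4 * (⌊ k /2⌋ * ⌈ k /2⌉) + 1
square≤ zero          = z≤n
square≤ (suc zero)    = ≤-refl
square≤ (suc (suc k)) = begin
  (2 + k) * (2 + k)                    ≡⟨ expand k ⟩
  k * k + 4 * k + 4                    ≤⟨ +-monoˡ-≤ 4 (+-monoˡ-≤ (4 * k) (square≤ k)) ⟩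
  4 * (p * q) + 1 + 4 * k + 4          ≡⟨ cong (λ m → 4 * (p * q) + 1 + 4 * m + 4) (⌊n/2⌋+⌈n/2⌉≡n k) ⟨
  4 * (p * q) + 1 + 4 * (p + q) + 4    ≡⟨ regroup p q ⟩
  4 * (suc p * suc q) + 1              ∎
  where
  open ≤-Reasoning
  p = ⌊ k /2⌋
  q = ⌈ k /2⌉
  expand : ∀ k → (2 + k) * (2 + k) ≡ k * k + 4 * k + 4
  expand = solve-∀
  regroup : ∀ p q → 4 * (p * q) + 1 + 4 * (p + q) + 4 ≡ 4 * (suc p * suc q) + 1
  regroup = solve-∀

quarter-square : ∀ {e k} → 4 * e ≤ k * k → e ≤ ⌊ k /2⌋ * ⌈ k /2⌉
quarter-square {e} {k} 4e≤k² = s≤s⁻¹ (*-cancelˡ-< 4 e (suc pq) (begin-strict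
  4 * e           ≤⟨ 4e≤k² ⟩
  k * k           ≤⟨ square≤ k ⟩
  4 * pq + 1      <⟨ +-monoʳ-< (4 * pq) (s≤s (s≤s z≤n)) ⟩
  4 * pq + 4      ≡⟨ +-comm (4 * pq) 4 ⟩
  4 + 4 * pq      ≡⟨ *-suc 4 pq ⟨
  4 * suc pq      ∎))
  where
  open ≤-Reasoning
  pq = ⌊ k /2⌋ * ⌈ k /2⌉

mantel : ∀ {n} {S : Pred n} {E : Digraph n} → Symmetric E → TriangleFree E → E ⊆² S →
  edges E ≤ ⌊ count S /2⌋ * ⌈ count S /2⌉
mantel {S = S} {E} E-sym tf E⊆S² = quarter-square {k = count S} (begin
  4 * edges E          ≡⟨ *-assoc 2 2 (edges E) ⟩
  2 * (2 * edges E)    ≡⟨ cong (2 *_) (arcs≡2*edges {E = E} E-sym (λ a Eaa → tf a a a Eaa Eaa Eaa)) ⟨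
  2 * arcs E           ≡⟨ cong (2 *_) (arcsIn≡arcs {S = S} {E} E⊆S²) ⟨
  2 * arcsIn S E       ≤⟨ mantel-arcsIn tf S ⟩
  count S * count S    ∎)
  where open ≤-Reasoning

bipartite : ∀ {n} → Pred n → Pred n → Digraph n
bipartite A B a b = (A a ∧ B b) ∨ (A b ∧ B a)

bipartite-sym : ∀ {n} (A B : Pred n) → Symmetric (bipartite A B)
bipartite-sym A B a b = ∨-comm (A a ∧ B b) (A b ∧ B a)

bipartite-across : ∀ {n} (A B : Pred n) {a b} → bipartite A B a b ≡ true →
  (A a ≡ true × B b ≡ true) ⊎ (A b ≡ true × B a ≡ true)
bipartite-across A B {a} {b} e with ∨-true {A a ∧ B b} e
... | inj₁ ab = inj₁ (∧-true ab)
... | inj₂ ba = inj₂ (∧-true ba)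

bipartite-⊆² : ∀ {n} {A B S : Pred n} → A ⊆ S → B ⊆ S → bipartite A B ⊆² S
bipartite-⊆² {A = A} {B} A⊆S B⊆S e with bipartite-across A B e
... | inj₁ (Aa , Bb) = A⊆S Aa , B⊆S Bb
... | inj₂ (Ab , Ba) = B⊆S Ba , A⊆S Ab

bipartite-triangleFree : ∀ {n} (A B : Pred n) → Disjoint A B → TriangleFree (bipartite A B)
bipartite-triangleFree A B A∩B=∅ _ _ _ ab bd ad
  with bipartite-across A B ab | bipartite-across A B bd | bipartite-across A B ad
... | inj₁ (_ , Bb) | inj₁ (Ab , _) | _             = A∩B=∅ Ab Bb
... | inj₁ (_ , _)  | inj₂ (Ad , _) | inj₁ (_ , Bd) = A∩B=∅ Ad Bd
... | inj₁ (Aa , _) | inj₂ (_ , _)  | inj₂ (_ , Ba) = A∩B=∅ Aa Ba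
... | inj₂ (_ , Ba) | inj₁ (_ , _)  | inj₁ (Aa , _) = A∩B=∅ Aa Ba
... | inj₂ (_ , _)  | inj₁ (_ , Bd) | inj₂ (Ad , _) = A∩B=∅ Ad Bd
... | inj₂ (Ab , _) | inj₂ (_ , Bb) | _             = A∩B=∅ Ab Bb

arcs-bipartite : ∀ {n} (A B : Pred n) → Disjoint A B → arcs (bipartite A B) ≡ 2 * (count A * count B)
arcs-bipartite {n} A B A∩B=∅ = begin
  arcs (bipartite A B)
    ≡⟨ sum-cong-≗ (λ a → sum-cong-≗ (split a)) ⟩
  ∑[ a < n ] ∑[ b < n ] (⟦ A a ⟧ * ⟦ B b ⟧ + ⟦ B a ⟧ * ⟦ A b ⟧)
    ≡⟨ ∑∑-distrib-+ (λ a b → ⟦ A a ⟧ * ⟦ B b ⟧) (λ a b → ⟦ B a ⟧ * ⟦ A b ⟧) ⟩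
  ∑[ a < n ] ∑[ b < n ] (⟦ A a ⟧ * ⟦ B b ⟧) + ∑[ a < n ] ∑[ b < n ] (⟦ B a ⟧ * ⟦ A b ⟧)
    ≡⟨ cong₂ _+_ (∑∑-product (λ a → ⟦ A a ⟧) (λ b → ⟦ B b ⟧))
                 (∑∑-product (λ a → ⟦ B a ⟧) (λ b → ⟦ A b ⟧)) ⟩
  count A * count B + count B * count A
    ≡⟨ cong (count A * count B +_) (trans (*-comm (count B) (count A)) (sym (+-identityʳ _))) ⟩
  2 * (count A * count B)
    ∎
  where
  open ≡-Reasoning
  split : ∀ a b → ⟦ bipartite A B a b ⟧ ≡ ⟦ A a ⟧ * ⟦ B b ⟧ + ⟦ B a ⟧ * ⟦ A b ⟧
  split a b = trans (⟦∨⟧ (λ ab ba → A∩B=∅ (proj₁ (∧-true ab)) (proj₂ (∧-true ba))))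
                    (cong₂ _+_ (⟦∧⟧ (A a) (B b)) (trans (⟦∧⟧ (A b) (B a)) (*-comm ⟦ A b ⟧ ⟦ B a ⟧)))

edges-bipartite : ∀ {n} (A B : Pred n) → Disjoint A B → edges (bipartite A B) ≡ count A * count B
edges-bipartite A B A∩B=∅ = *-cancelˡ-≡ _ _ 2 (trans
  (sym (arcs≡2*edges {E = bipartite A B} (bipartite-sym A B)
                     (λ a aa → bipartite-triangleFree A B A∩B=∅ a a a aa aa aa)))
  (arcs-bipartite A B A∩B=∅))

-- Links of a 2→1 graph

link : ∀ {n} → Graph n → Fin n → Digraph n
link G c a b = edge G a b c

link-⊆² : ∀ {n} (G : Graph n) c → link G c ⊆² (full ─ c)
link-⊆² G c {a} {b} ab→c = ∈─ full refl (proj₁ (proj₂ (distinct G a b c ab→c)))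
                         , ∈─ full refl (proj₂ (proj₂ (distinct G a b c ab→c)))

numEdges≡∑edges-link : ∀ {n} (G : Graph n) → numEdges G ≡ ∑[ c < n ] edges (link G c)
numEdges≡∑edges-link {n} G = begin
  numEdges G                                    ≡⟨ ΣFin³≡∑³ ⟩
  ∑[ a < n ] ∑[ b < n ] ∑[ c < n ] arc a b c    ≡⟨ sum-cong-≗ (λ a → ∑-comm (arc a)) ⟩
  ∑[ a < n ] ∑[ c < n ] ∑[ b < n ] arc a b c    ≡⟨ ∑-comm (λ a c → ∑[ b < n ] arc a b c) ⟩
  ∑[ c < n ] ∑[ a < n ] ∑[ b < n ] arc a b c    ∎
  where
  open ≡-Reasoning
  arc : Fin n → Fin n → Fin n → ℕ
  arc a b c = ⟦ (toℕ a <ᵇ toℕ b) ∧ edge G a b c ⟧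
  ΣFin³≡∑³ : numEdges G ≡ ∑[ a < n ] ∑[ b < n ] ∑[ c < n ] arc a b c
  ΣFin³≡∑³ = trans (ΣFin≡sum n _) (sum-cong-≗ λ a →
             trans (ΣFin≡sum n _) (sum-cong-≗ λ b → ΣFin≡sum n (arc a b)))

isD⇒≡3F : ∀ {w} → isD w ≡ true → w ≡ 3F
isD⇒≡3F {3F} _ = refl

Free⇒triangleFree-link : ∀ {n} (G : Graph n) → Free TT4⁻ G → ∀ c → TriangleFree (link G c)
Free⇒triangleFree-link {n} G free c a b d ab→c bd→c ad→c = free (φ , injective , hom)
  where
  a≢b = proj₁ (distinct G a b c ab→c)
  a≢c = proj₁ (proj₂ (distinct G a b c ab→c))
  b≢c = proj₂ (proj₂ (distinct G a b c ab→c))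
  b≢d = proj₁ (distinct G b d c bd→c)
  d≢c = proj₂ (proj₂ (distinct G b d c bd→c))
  a≢d = proj₁ (distinct G a d c ad→c)
  φ : Fin 4 → Fin n
  φ 0F = a
  φ 1F = b
  φ 2F = d
  φ 3F = c
  injective : ∀ {i j} → φ i ≡ φ j → i ≡ j
  injective {0F} {0F} _ = refl
  injective {0F} {1F} e = ⊥-elim (a≢b e)
  injective {0F} {2F} e = ⊥-elim (a≢d e)
  injective {0F} {3F} e = ⊥-elim (a≢c e)
  injective {1F} {0F} e = ⊥-elim (a≢b (sym e))
  injective {1F} {1F} _ = refl
  injective {1F} {2F} e = ⊥-elim (b≢d e)
  injective {1F} {3F} e = ⊥-elim (b≢c e)
  injective {2F} {0F} e = ⊥-elim (a≢d (sym e))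
  injective {2F} {1F} e = ⊥-elim (b≢d (sym e))
  injective {2F} {2F} _ = refl
  injective {2F} {3F} e = ⊥-elim (d≢c e)
  injective {3F} {0F} e = ⊥-elim (a≢c (sym e))
  injective {3F} {1F} e = ⊥-elim (b≢c (sym e))
  injective {3F} {2F} e = ⊥-elim (d≢c (sym e))
  injective {3F} {3F} _ = refl
  into-c : ∀ u v → pairOK u v ≡ true → edge G (φ u) (φ v) c ≡ true
  into-c 0F 1F _ = ab→c
  into-c 1F 0F _ = trans (Graph.sym G b a c) ab→c
  into-c 1F 2F _ = bd→c
  into-c 2F 1F _ = trans (Graph.sym G d b c) bd→c
  into-c 0F 2F _ = ad→c
  into-c 2F 0F _ = trans (Graph.sym G d a c) ad→c
  hom : IsHom TT4⁻ G φ
  hom u v w uv→w with refl ← isD⇒≡3F (proj₂ (∧-true {pairOK u v} uv→w)) =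
    into-c u v (proj₁ (∧-true uv→w))

triangleFree-link⇒Free : ∀ {n} (G : Graph n) → (∀ c → TriangleFree (link G c)) → Free TT4⁻ G
triangleFree-link⇒Free G tf (φ , _ , hom) =
  tf (φ 3F) (φ 0F) (φ 1F) (φ 2F) (hom 0F 1F 3F refl) (hom 1F 2F 3F refl) (hom 0F 2F 3F refl)

Free⇒numEdges≤ : ∀ {n} (G : Graph n) → Free TT4⁻ G → numEdges G ≤ n * (⌊ n ∸ 1 /2⌋ * ⌈ n ∸ 1 /2⌉)
Free⇒numEdges≤ {n} G free = begin
  numEdges G                                ≡⟨ numEdges≡∑edges-link G ⟩
  ∑[ c < n ] edges (link G c)               ≤⟨ sum-mono-≤ link-mantel ⟩
  ∑[ c < n ] (⌊ n ∸ 1 /2⌋ * ⌈ n ∸ 1 /2⌉)    ≡⟨ sum-const n _ ⟩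
  n * (⌊ n ∸ 1 /2⌋ * ⌈ n ∸ 1 /2⌉)           ∎
  where
  open ≤-Reasoning
  link-mantel : ∀ c → edges (link G c) ≤ ⌊ n ∸ 1 /2⌋ * ⌈ n ∸ 1 /2⌉
  link-mantel c = subst (λ k → edges (link G c) ≤ ⌊ k /2⌋ * ⌈ k /2⌉) (count-full─ c)
    (mantel (λ a b → Graph.sym G a b c) (Free⇒triangleFree-link G free c) (link-⊆² G c))

-- The extremal construction

-- lower c consists of the first ⌊(n−1)/2⌋ vertices other than c, upper c of the rest.
threshold : ∀ {n} → Fin n → ℕ
threshold {n} c = ⌊ n ∸ 1 /2⌋ + ⟦ toℕ c <ᵇ ⌊ n ∸ 1 /2⌋ ⟧

lower upper : ∀ {n} → Fin n → Pred n
lower c = (full ─ c) ∩ below (threshold c)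
upper c = (full ─ c) ∩ ∁ (below (threshold c))

threshold≤n : ∀ {n} (c : Fin n) → threshold c ≤ n
threshold≤n {suc m} c = ≤-trans (+-monoʳ-≤ ⌊ m /2⌋ (⟦⟧≤1 (toℕ c <ᵇ ⌊ m /2⌋)))
                                (≤-trans (≤-reflexive (+-comm ⌊ m /2⌋ 1)) (s≤s (⌊n/2⌋≤n m)))
  where
  ⟦⟧≤1 : ∀ b → ⟦ b ⟧ ≤ 1
  ⟦⟧≤1 true  = ≤-refl
  ⟦⟧≤1 false = z≤n

below-threshold : ∀ {n} (c : Fin n) → below (threshold c) c ≡ below ⌊ n ∸ 1 /2⌋ c
below-threshold {n} c with toℕ c <ᵇ ⌊ n ∸ 1 /2⌋ | <ᵇ-reflects-< (toℕ c) ⌊ n ∸ 1 /2⌋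
... | true  | ofʸ c<h = <ᵇ-true (m≤n⇒m≤n+o 1 c<h)
... | false | ofⁿ c≮h = <ᵇ-false (subst (λ h → ¬ toℕ c < h) (sym (+-identityʳ _)) c≮h)

count-lower : ∀ {n} (c : Fin n) → count (lower c) ≡ ⌊ n ∸ 1 /2⌋
count-lower {n} c = +-cancelˡ-≡ δ _ _ (begin
  δ + count (lower c)        ≡⟨ cong (δ +_) (count-full─∩ P c) ⟩
  δ + count (P ─ c)          ≡⟨ cong (λ b → ⟦ b ⟧ + count (P ─ c)) (below-threshold c) ⟨
  ⟦ P c ⟧ + count (P ─ c)    ≡⟨ count-─ P c ⟨
  count P                    ≡⟨ count-below (threshold c) (threshold≤n c) ⟩
  ⌊ n ∸ 1 /2⌋ + δ            ≡⟨ +-comm ⌊ n ∸ 1 /2⌋ δ ⟩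
  δ + ⌊ n ∸ 1 /2⌋            ∎)
  where
  open ≡-Reasoning
  P = below (threshold c)
  δ = ⟦ below ⌊ n ∸ 1 /2⌋ c ⟧

count-upper : ∀ {n} (c : Fin n) → count (upper c) ≡ ⌈ n ∸ 1 /2⌉
count-upper {n} c = +-cancelˡ-≡ ⌊ n ∸ 1 /2⌋ _ _ (begin
  ⌊ n ∸ 1 /2⌋ + count (upper c)       ≡⟨ cong (_+ count (upper c)) (count-lower c) ⟨
  count (lower c) + count (upper c)   ≡⟨ count-∩-∁ (full ─ c) (below (threshold c)) ⟩
  count (full ─ c)                    ≡⟨ count-full─ c ⟩
  n ∸ 1                               ≡⟨ ⌊n/2⌋+⌈n/2⌉≡n (n ∸ 1) ⟨
  ⌊ n ∸ 1 /2⌋ + ⌈ n ∸ 1 /2⌉           ∎)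
  where open ≡-Reasoning

lower∩upper=∅ : ∀ {n} (c : Fin n) → Disjoint (lower c) (upper c)
lower∩upper=∅ c = ∩-∁-disjoint (full ─ c) (below (threshold c))

balancedLink : ∀ {n} → Fin n → Digraph n
balancedLink c = bipartite (lower c) (upper c)

balancedLink-triangleFree : ∀ {n} (c : Fin n) → TriangleFree (balancedLink c)
balancedLink-triangleFree c = bipartite-triangleFree (lower c) (upper c) (lower∩upper=∅ c)

balancedLink-⊆² : ∀ {n} (c : Fin n) → balancedLink c ⊆² (full ─ c)
balancedLink-⊆² c {a} {b} = bipartite-⊆² {A = lower c} {upper c} {full ─ c}
  (∩-⊆ (full ─ c) (below (threshold c))) (∩-⊆ (full ─ c) (∁ (below (threshold c)))) {a} {b}

balancedLinks : ∀ n → Graph n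
balancedLinks n = record
  { edge     = λ a b c → balancedLink c a b
  ; sym      = λ a b c → bipartite-sym (lower c) (upper c) a b
  ; distinct = λ a b c ab→c →
        triangleFree⇒loopless {E = balancedLink c} (balancedLink-triangleFree c) {a} {b} ab→c
      , ∈─⇒≢ full (proj₁ (balancedLink-⊆² c {a} {b} ab→c))
      , ∈─⇒≢ full (proj₂ (balancedLink-⊆² c {a} {b} ab→c))
  }

balancedLinks-free : ∀ n → Free TT4⁻ (balancedLinks n)
balancedLinks-free n = triangleFree-link⇒Free (balancedLinks n) balancedLink-triangleFree

numEdges-balancedLinks : ∀ n → numEdges (balancedLinks n) ≡ n * (⌊ n ∸ 1 /2⌋ * ⌈ n ∸ 1 /2⌉)
numEdges-balancedLinks n = begin
  numEdges (balancedLinks n)                     ≡⟨ numEdges≡∑edges-link (balancedLinks n) ⟩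
  ∑[ c < n ] edges (balancedLink c)              ≡⟨ sum-cong-≗ link-edges ⟩
  ∑[ c < n ] (⌊ n ∸ 1 /2⌋ * ⌈ n ∸ 1 /2⌉)         ≡⟨ sum-const n _ ⟩
  n * (⌊ n ∸ 1 /2⌋ * ⌈ n ∸ 1 /2⌉)                ∎
  where
  open ≡-Reasoning
  link-edges : ∀ (c : Fin n) → edges (balancedLink c) ≡ ⌊ n ∸ 1 /2⌋ * ⌈ n ∸ 1 /2⌉
  link-edges c = trans (edges-bipartite (lower c) (upper c) (lower∩upper=∅ c))
                       (cong₂ _*_ (count-lower c) (count-upper c))

theorem6 : ∀ (n : ℕ) → IsEx TT4⁻ n (n * ⌊ n ∸ 1 /2⌋ * ⌈ n ∸ 1 /2⌉)
theorem6 n =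
    (balancedLinks n , balancedLinks-free n , trans (numEdges-balancedLinks n) (sym (*-assoc n _ _)))
  , λ G free → subst (numEdges G ≤_) (sym (*-assoc n _ _)) (Free⇒numEdges≤ G free)
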